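{- Let $G$ be an arbitrary $n$-vertex graph such that both $G$ and its complement $\overline{G}$ have diameter at most 2. Form a graph $G'$ on vertex set $A\cup B$, where $A$ and $B$ are two disjoint copies of $V(G)$, by placing a copy of $G$ induced on $A$, a copy of $\overline{G}$ induced on $B$, and a perfect matching between $A$ and $B$ joining each vertex of $A$ to its copy in $B$. Then $G'$ is diameter-2-critical.
   Context: All graphs are finite and simple. The diameter of a graph is the maximum over vertex pairs of the length of a shortest path between them ($\infty$ if disconnected). A graph is diameter-2-critical if its diameter is 2 and deleting any single edge yields a graph of diameter strictly larger than 2. -}

module Defs where

open import Level using (0ℓ)
open import Data.Nat using (ℕ)
open import Data.Fin using (Fin)
open import Data.Sum using (_⊎_; inj₁; inj₂)
open import Data.Product using (_×_; ∃; ∃-syntax)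
open import Relation.Nullary using (¬_; Dec)
open import Relation.Binary.PropositionalEquality using (_≡_; _≢_; refl)
import Relation.Binary.PropositionalEquality as Eq
open import Relation.Binary.Definitions using (DecidableEquality)
open import Relation.Nullary using (yes; no)
open import Relation.Nullary.Decidable using (_×-dec_; ¬?)
open import Data.Fin using (_≟_)
open import Data.Product using (_,_)

record Graph (V : Set) : Set₁ where
  field
    Adj   : V → V → Set
    dec   : ∀ x y → Dec (Adj x y)
    sym   : ∀ {x y} → Adj x y → Adj y x
    irrefl : ∀ {x} → ¬ Adj x x
open Graph public

Within2 : {V : Set} → (V → V → Set) → V → V → Set
Within2 E x y = x ≡ y ⊎ E x y ⊎ ∃[ z ] (E x z × E z y)

DiamLe2 : {V : Set} → (V → V → Set) → Set
DiamLe2 E = ∀ x y → Within2 E x y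

Diam2 : {V : Set} → (V → V → Set) → Set
Diam2 E = DiamLe2 E × ∃[ x ] ∃[ y ] (x ≢ y × ¬ E x y)

deleteEdge : {V : Set} → (V → V → Set) → V → V → V → V → Set
deleteEdge E u v x y = E x y × ¬ ((x ≡ u × y ≡ v) ⊎ (x ≡ v × y ≡ u))

Diam2Critical : {V : Set} → Graph V → Set
Diam2Critical G = Diam2 (Adj G) × (∀ u v → Adj G u v → ¬ DiamLe2 (deleteEdge (Adj G) u v))

ComplAdj : {V : Set} → Graph V → V → V → Set
ComplAdj G x y = x ≢ y × ¬ Adj G x y

-- G' on A ∪ B (A = inj₁, B = inj₂): G on A, complement of G on B,
-- and the perfect matching a ↔ copy of a in B.
DoubleAdj : {V : Set} → Graph V → V ⊎ V → V ⊎ V → Set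
DoubleAdj G (inj₁ x) (inj₁ y) = Adj G x y
DoubleAdj G (inj₂ x) (inj₂ y) = ComplAdj G x y
DoubleAdj G (inj₁ x) (inj₂ y) = x ≡ y
DoubleAdj G (inj₂ x) (inj₁ y) = x ≡ y

doubleGraph : {n : ℕ} → Graph (Fin n) → Graph (Fin n ⊎ Fin n)
doubleGraph {n} G = record { Adj = DoubleAdj G ; dec = d ; sym = λ {x} {y} → s {x} {y} ; irrefl = λ {x} → i {x} }
  where
  d : ∀ x y → Dec (DoubleAdj G x y)
  d (inj₁ x) (inj₁ y) = dec G x y
  d (inj₂ x) (inj₂ y) = ¬? (x ≟ y) ×-dec ¬? (dec G x y)
  d (inj₁ x) (inj₂ y) = x ≟ y
  d (inj₂ x) (inj₁ y) = x ≟ y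
  s : ∀ {x y} → DoubleAdj G x y → DoubleAdj G y x
  s {inj₁ x} {inj₁ y} a = sym G a
  s {inj₂ x} {inj₂ y} (ne , na) = (λ e → ne (Eq.sym e)) , (λ a → na (sym G a))
  s {inj₁ x} {inj₂ y} e = Eq.sym e
  s {inj₂ x} {inj₁ y} e = Eq.sym e
  i : ∀ {x} → ¬ DoubleAdj G x x
  i {inj₁ x} a = irrefl G a
  i {inj₂ x} (ne , _) = ne refl

-- Both G and its complement have diameter at most 2, so inside each copy
-- distances are at most 2, and a vertex of A reaches a vertex of B either
-- through its own matching edge or through the matching edge of its
-- G-neighbour.  Criticality needs no hypothesis on G: deleting an edge xy of
-- A (resp. B) leaves the matching pair x_A, y_B (resp. x_B, y_A) with no
-- common neighbour, because their only one was the endpoint y on the far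
-- side of the deleted edge; deleting a matching edge x_A x_B separates its
-- endpoints, which never have a common neighbour.
module Submission where

open import Defs
open import Data.Nat using (ℕ; _≤_; z≤n; s≤s)
open import Data.Fin using (Fin; zero; suc; _≟_)
open import Data.Sum using (inj₁; inj₂; [_,_]′)
open import Data.Product using (_,_)
open import Function using (id)
open import Relation.Nullary using (¬_; yes; no)
open import Relation.Binary.PropositionalEquality using (_≡_; refl)

module _ {V W : Set} {E : V → V → Set} {F : W → W → Set} where

  Within2-map : (f : V → W) → (∀ {x y} → E x y → F (f x) (f y)) →
                ∀ {x y} → Within2 E x y → Within2 F (f x) (f y)
  Within2-map f hom (inj₁ refl)                  = inj₁ refl
  Within2-map f hom (inj₂ (inj₁ e))              = inj₂ (inj₁ (hom e))
  Within2-map f hom (inj₂ (inj₂ (z , e₁ , e₂))) = inj₂ (inj₂ (f z , hom e₁ , hom e₂))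

module _ {V : Set} {E : V → V → Set} where

  Within2-sym : (∀ {x y} → E x y → E y x) → ∀ {x y} → Within2 E x y → Within2 E y x
  Within2-sym sym (inj₁ refl)                  = inj₁ refl
  Within2-sym sym (inj₂ (inj₁ e))              = inj₂ (inj₁ (sym e))
  Within2-sym sym (inj₂ (inj₂ (z , e₁ , e₂))) = inj₂ (inj₂ (z , sym e₂ , sym e₁))

  deleteEdge-comm : ∀ {u v x y} → deleteEdge E u v x y → deleteEdge E v u x y
  deleteEdge-comm (e , notDeleted) = e , λ d → notDeleted ([ inj₂ , inj₁ ]′ d)

  Within2-deleteEdge-comm : ∀ {u v x y} →
    Within2 (deleteEdge E u v) x y → Within2 (deleteEdge E v u) x y
  Within2-deleteEdge-comm {u} {v} = Within2-map id (λ {x} {y} → deleteEdge-comm {u} {v} {x} {y})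

module _ {n : ℕ} (G : Graph (Fin n)) where

  private
    D = DoubleAdj G

  Within2-cross : ∀ x y → Within2 D (inj₁ x) (inj₂ y)
  Within2-cross x y with x ≟ y
  ... | yes x≡y = inj₂ (inj₁ x≡y)
  ... | no x≢y with dec G x y
  ...   | yes xy = inj₂ (inj₂ (inj₁ y , xy , refl))
  ...   | no ¬xy = inj₂ (inj₂ (inj₂ x , refl , x≢y , ¬xy))

  doubleGraph-diamLe2 : DiamLe2 (Adj G) → DiamLe2 (ComplAdj G) → DiamLe2 D
  doubleGraph-diamLe2 diamG diamḠ (inj₁ x) (inj₁ y) = Within2-map {F = D} inj₁ id (diamG x y)
  doubleGraph-diamLe2 diamG diamḠ (inj₂ x) (inj₂ y) = Within2-map {F = D} inj₂ id (diamḠ x y)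
  doubleGraph-diamLe2 diamG diamḠ (inj₁ x) (inj₂ y) = Within2-cross x y
  doubleGraph-diamLe2 diamG diamḠ (inj₂ x) (inj₁ y) =
    Within2-sym {E = D} (λ {x} {y} → sym (doubleGraph G) {x} {y}) (Within2-cross y x)

  deleteEdge-A-separates : ∀ {x y} → Adj G x y →
    ¬ Within2 (deleteEdge D (inj₁ x) (inj₁ y)) (inj₁ x) (inj₂ y)
  deleteEdge-A-separates xy (inj₁ ())
  deleteEdge-A-separates xy (inj₂ (inj₁ (refl , _))) = irrefl G xy
  deleteEdge-A-separates xy (inj₂ (inj₂ (inj₁ z , (_ , deleted) , refl , _))) =
    deleted (inj₁ (refl , refl))
  deleteEdge-A-separates xy (inj₂ (inj₂ (inj₂ z , (refl , _) , (_ , ¬xy) , _))) = ¬xy xy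

  deleteEdge-B-separates : ∀ {x y} → ComplAdj G x y →
    ¬ Within2 (deleteEdge D (inj₂ x) (inj₂ y)) (inj₂ x) (inj₁ y)
  deleteEdge-B-separates (x≢y , _) (inj₁ ())
  deleteEdge-B-separates (x≢y , _) (inj₂ (inj₁ (x≡y , _))) = x≢y x≡y
  deleteEdge-B-separates (_ , ¬xy) (inj₂ (inj₂ (inj₁ z , (refl , _) , xy , _))) = ¬xy xy
  deleteEdge-B-separates _ (inj₂ (inj₂ (inj₂ z , (_ , deleted) , refl , _))) =
    deleted (inj₁ (refl , refl))

  deleteEdge-matching-separates : ∀ {x} →
    ¬ Within2 (deleteEdge D (inj₁ x) (inj₂ x)) (inj₁ x) (inj₂ x)
  deleteEdge-matching-separates (inj₁ ())
  deleteEdge-matching-separates (inj₂ (inj₁ (_ , deleted))) = deleted (inj₁ (refl , refl))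
  deleteEdge-matching-separates (inj₂ (inj₂ (inj₁ z , (xx , _) , refl , _))) = irrefl G xx
  deleteEdge-matching-separates (inj₂ (inj₂ (inj₂ z , (refl , _) , (x≢x , _) , _))) = x≢x refl

  deleteEdge-breaks-diamLe2 : ∀ u v → D u v → ¬ DiamLe2 (deleteEdge D u v)
  deleteEdge-breaks-diamLe2 (inj₁ x) (inj₁ y) xy diam =
    deleteEdge-A-separates xy (diam (inj₁ x) (inj₂ y))
  deleteEdge-breaks-diamLe2 (inj₂ x) (inj₂ y) xy diam =
    deleteEdge-B-separates xy (diam (inj₂ x) (inj₁ y))
  deleteEdge-breaks-diamLe2 (inj₁ x) (inj₂ .x) refl diam =
    deleteEdge-matching-separates (diam (inj₁ x) (inj₂ x))
  deleteEdge-breaks-diamLe2 (inj₂ x) (inj₁ .x) refl diam =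
    deleteEdge-matching-separates (Within2-deleteEdge-comm {E = D} (diam (inj₁ x) (inj₂ x)))

mainTheorem6 : (n : ℕ) → 2 ≤ n → (G : Graph (Fin n)) →
    DiamLe2 (Adj G) → DiamLe2 (ComplAdj G) →
    Diam2Critical (doubleGraph G)
mainTheorem6 _ (s≤s (s≤s z≤n)) G diamG diamḠ =
  (doubleGraph-diamLe2 G diamG diamḠ , inj₁ zero , inj₂ (suc zero) , (λ ()) , (λ ())) ,
  deleteEdge-breaks-diamLe2 G
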